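{- Let $\lambda=(a,b)$ be a two-row shape with $a\ge b\ge 1$. Then $$\xi(q)=\sum_k\vert S_k(\lambda)\vert q^k=\sum_{i\ge0}\vert\mathcal{D}_\lambda(i)\vert(1+q)^i.$$
   Context: $S_k(\lambda)$ is the set of fillings of the two-row Young diagram with row lengths $a$ (top), $b$ (bottom) by $1,\dots,a+b$ (each once), increasing along rows, having exactly $k$ inversion pairs, where for entries $i<j$ in one column, with $i_k,j_k$ the entries $k$ boxes to the right, $(i,j)$ is an inversion pair if (1) $i_1$ or $j_1$ is missing and $i$ is below $j$; (2) $i_1>j_1$; (3) $i_k=j_k$ for $k\le n$, $i_{n+1}$ or $j_{n+1}$ missing, and $i$ below $j$; or (4) $i_k=j_k$ for $k\le n$ and $i_{n+1}>j_{n+1}$. A Dyck path of shape $(a,b)$ is a lattice path from $(0,0)$ to $(a,b)$ with steps $(1,0)$ and $(0,1)$ all of whose points $(x,y)$ satisfy $y\le x$; it has a return to ground at a vertex $(x,x)$ with $x>0$. $\mathcal{D}_\lambda(i)$ is the set of such paths with exactly $i$ returns to ground. -}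

module Defs where

open import Data.Nat using (ℕ; zero; suc; _+_; _*_; _≤ᵇ_; _<ᵇ_; _≡ᵇ_)
open import Data.Bool using (Bool; true; false; _∧_; if_then_else_; not)
open import Data.List using (List; []; _∷_; [_]; map; concatMap; filter; length; upTo; _++_)
open import Data.Nat.ListAction using (sum)
open import Data.Bool.ListAction using (all; any)
open import Data.Vec as V using (Vec)
open import Data.Maybe using (Maybe; just; nothing)
open import Data.Nat.Combinatorics using (_C_)
open import Relation.Nullary.Decidable using (yes; no)
open import Data.Bool using (T?)

range : ℕ → List ℕ
range n = map suc (upTo n)

vecsOver : List ℕ → (n : ℕ) → List (Vec ℕ n)
vecsOver xs zero = [ V.[] ]
vecsOver xs (suc n) = concatMap (λ x → map (x V.∷_) (vecsOver xs n)) xs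

countB : {A : Set} → (A → Bool) → List A → ℕ
countB p xs = length (filter (λ x → T? (p x)) xs)

-- Fillings of the two-row diagram (a, b): top row of length a, bottom
-- row of length b, left-justified (column c holds top[c] and, if c < b,
-- bottom[c]).

record Filling (a b : ℕ) : Set where
  constructor mkFilling
  field
    top    : Vec ℕ a
    bottom : Vec ℕ b
open Filling public

strictlyIncreasing : List ℕ → Bool
strictlyIncreasing [] = true
strictlyIncreasing (x ∷ []) = true
strictlyIncreasing (x ∷ y ∷ xs) = (x <ᵇ y) ∧ strictlyIncreasing (y ∷ xs)

elemB : ℕ → List ℕ → Bool
elemB m xs = any (λ x → m ≡ᵇ x) xs

-- a valid filling: rows increasing, entries in {1..a+b}, each of
-- 1..a+b occurring (hence exactly once, as there are a+b boxes)
isFilling : {a b : ℕ} → Filling a b → Bool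
isFilling {a} {b} f =
  strictlyIncreasing (V.toList (top f)) ∧
  strictlyIncreasing (V.toList (bottom f)) ∧
  all (λ x → (1 ≤ᵇ x) ∧ (x ≤ᵇ (a + b))) (V.toList (top f) ++ V.toList (bottom f)) ∧
  all (λ m → elemB m (V.toList (top f) ++ V.toList (bottom f))) (range (a + b))

entry : List ℕ → ℕ → Maybe ℕ
entry [] c = nothing
entry (x ∷ xs) zero = just x
entry (x ∷ xs) (suc c) = entry xs c

-- Scan to the right, starting at column c, of the rows ri (row of i)
-- and rj (row of j); 'iBelow' says whether i lies in the bottom row.
-- At step k the entries i_k, j_k are compared: if one is missing the
-- pair is an inversion iff i is below j (conditions (1)/(3)); if both
-- exist and i_k > j_k it is an inversion ((2)/(4)); if i_k = j_k we
-- continue to step k+1; otherwise (i_k < j_k) it is not an inversion.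
-- The fuel is always large enough (a row ends after finitely many steps).
scan : ℕ → List ℕ → List ℕ → ℕ → Bool → Bool
scan zero ri rj c iBelow = false
scan (suc fuel) ri rj c iBelow with entry ri c | entry rj c
... | just x | just y =
  if y <ᵇ x then true else (if x ≡ᵇ y then scan fuel ri rj (suc c) iBelow else false)
... | just x | nothing = iBelow
... | nothing | _ = iBelow

-- Is the pair of entries in column c an inversion pair?
-- i is the smaller of the two entries, j the larger.
columnInversion : {a b : ℕ} → Filling a b → ℕ → Bool
columnInversion {a} {b} f c with entry (V.toList (top f)) c | entry (V.toList (bottom f)) c
... | just t | just u =
  if u <ᵇ t
  then scan (suc (a + b)) (V.toList (bottom f)) (V.toList (top f)) (suc c) true
  else scan (suc (a + b)) (V.toList (top f)) (V.toList (bottom f)) (suc c) false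
... | _ | _ = false

-- number of inversion pairs (one candidate pair per two-box column)
inversions : {a b : ℕ} → Filling a b → ℕ
inversions {a} {b} f = countB (columnInversion f) (upTo a)

allFillings : (a b : ℕ) → List (Filling a b)
allFillings a b =
  concatMap (λ t → map (mkFilling t) (vecsOver (range (a + b)) b))
            (vecsOver (range (a + b)) a)

cardS : (a b k : ℕ) → ℕ
cardS a b k = countB (λ f → isFilling f ∧ (inversions f ≡ᵇ k)) (allFillings a b)

-- Lattice paths: true = east step (1,0), false = north step (0,1).

allPaths : ℕ → List (List Bool)
allPaths zero = [ [] ]
allPaths (suc n) = concatMap (λ s → map (s ∷_) (allPaths n)) (true ∷ false ∷ [])

dyckFrom : ℕ → ℕ → ℕ → ℕ → List Bool → Bool
dyckFrom a b x y [] = (x ≡ᵇ a) ∧ (y ≡ᵇ b)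
dyckFrom a b x y (true ∷ p) = dyckFrom a b (suc x) y p
dyckFrom a b x y (false ∷ p) = (suc y ≤ᵇ x) ∧ dyckFrom a b x (suc y) p

isDyck : ℕ → ℕ → List Bool → Bool
isDyck a b p = dyckFrom a b 0 0 p

-- number of vertices (x, x), x > 0, visited after the current point (x, y)
returnsFrom : ℕ → ℕ → List Bool → ℕ
returnsFrom x y [] = 0
returnsFrom x y (true ∷ p) =
  (if suc x ≡ᵇ y then 1 else 0) + returnsFrom (suc x) y p
returnsFrom x y (false ∷ p) =
  (if x ≡ᵇ suc y then 1 else 0) + returnsFrom x (suc y) p

returns : List Bool → ℕ
returns p = returnsFrom 0 0 p

cardD : (a b i : ℕ) → ℕ
cardD a b i = countB (λ p → isDyck a b p ∧ (returns p ≡ᵇ i)) (allPaths (a + b))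

-- Coefficient of q^k in  Σ_{i ≥ 0} |D_λ(i)| (1+q)^i  (i ranges over
-- 0..a+b, beyond which D_λ(i) is empty), by the binomial theorem.
rhsCoeff : (a b k : ℕ) → ℕ
rhsCoeff a b k = sum (map (λ i → cardD a b i * (i C k)) (upTo (suc (a + b))))

{-# OPTIONS --safe #-}

-- Record a filling by the word whose k-th letter says whether k lies in the top row, i.e. by a
-- lattice path from (0, 0) to (a, b).  No value occurs in both rows, so column c is an inversion
-- exactly when "bottom entry < top entry" changes truth value between columns c and c + 1 (a
-- missing bottom entry counting as false), and "bottom < top" in column c says that the c-th north
-- step of the path starts on or above the diagonal.  So the inversions count the changes of side of
-- the path, the final side being below.  Cut a path at its returns to the diagonal: every excursion
-- may be reflected independently, and a path folds onto a Dyck path with i returns in 2^i ways,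
-- whose numbers of changes give (1 + q)^i.  This is carried out as an induction on the length of the
-- rest of the path, keeping track of the parity of the number of changes.

module Submission where

open import Defs
open import Data.Bool as Bool using (Bool; true; false; _∧_; _∨_; not; _xor_; if_then_else_; T)
open import Data.Bool.ListAction using (all)
open import Data.Bool.Properties using (∨-assoc; ∨-zeroʳ; ∧-zeroʳ; if-eta; not-involutive; xor-identityʳ; xor-comm)
open import Data.Empty using (⊥-elim)
open import Data.List using (List; []; _∷_; [_]; map; concatMap; length; upTo; applyUpTo; _++_; zipWith; drop)
import Data.List.Properties as List
open import Data.List.Relation.Unary.All as All using (All; []; _∷_)
open import Data.List.Relation.Unary.All.Properties using (++⁺; ++⁻; drop⁺; map⁺)
open import Data.Maybe using (Maybe; just; nothing)
open import Data.Nat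
  using (ℕ; zero; suc; _+_; _*_; _∸_; _≤_; _<_; z≤n; s≤s; z<s; _≤ᵇ_; _<ᵇ_; _≡ᵇ_; _≟_; _≤?_; _<?_)
open import Data.Nat.Combinatorics using (_C_; nCk+nC[k+1]≡[n+1]C[k+1])
open import Data.Nat.ListAction using (sum)
open import Data.Nat.Properties
open import Algebra.Properties.CommutativeSemigroup +-commutativeSemigroup using (interchange)
open import Data.Product using (_×_; _,_; proj₁; proj₂; uncurry)
open import Data.Sum using (inj₁; inj₂)
open import Data.Vec as Vec using (Vec)
import Data.Vec.Properties as Vec
open import Function using (_∘_)
open import Relation.Binary using (DecidableEquality; tri<; tri≈; tri>)
open import Relation.Binary.PropositionalEquality hiding ([_])
import Relation.Binary.Reasoning.Setoid
open import Relation.Nullary using (¬_; yes; no; does; _×-dec_)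
open import Relation.Nullary.Decidable using (dec-true; dec-false; map′)

-- Sums over lists and double counting

𝟙 : Bool → ℕ
𝟙 true = 1
𝟙 false = 0

sumOver : {A : Set} → List A → (A → ℕ) → ℕ
sumOver [] f = 0
sumOver (x ∷ xs) f = f x + sumOver xs f

infixr 6.5 sumOver
syntax sumOver xs (λ x → e) = ∑[ x ← xs ] e

private variable A B : Set

∑-cong : (xs : List A) {f g : A → ℕ} → (∀ x → f x ≡ g x) → sumOver xs f ≡ sumOver xs g
∑-cong [] f≗g = refl
∑-cong (x ∷ xs) f≗g = cong₂ _+_ (f≗g x) (∑-cong xs f≗g)

∑-congᴬ : {xs : List A} {f g : A → ℕ} → All (λ x → f x ≡ g x) xs → sumOver xs f ≡ sumOver xs g
∑-congᴬ [] = refl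
∑-congᴬ (e ∷ es) = cong₂ _+_ e (∑-congᴬ es)

∑-zero : (xs : List A) {f : A → ℕ} → (∀ x → f x ≡ 0) → sumOver xs f ≡ 0
∑-zero [] f≗0 = refl
∑-zero (x ∷ xs) f≗0 = cong₂ _+_ (f≗0 x) (∑-zero xs f≗0)

∑-++ : (xs ys : List A) (f : A → ℕ) → sumOver (xs ++ ys) f ≡ sumOver xs f + sumOver ys f
∑-++ [] ys f = refl
∑-++ (x ∷ xs) ys f = trans (cong (f x +_) (∑-++ xs ys f)) (sym (+-assoc (f x) _ _))

∑-+ : (xs : List A) (f g : A → ℕ) → ∑[ x ← xs ] (f x + g x) ≡ sumOver xs f + sumOver xs g
∑-+ [] f g = refl
∑-+ (x ∷ xs) f g = trans (cong (f x + g x +_) (∑-+ xs f g)) (interchange (f x) (g x) _ _)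

∑-*ˡ : (c : ℕ) (xs : List A) (f : A → ℕ) → ∑[ x ← xs ] (c * f x) ≡ c * sumOver xs f
∑-*ˡ c [] f = sym (*-zeroʳ c)
∑-*ˡ c (x ∷ xs) f = trans (cong (c * f x +_) (∑-*ˡ c xs f)) (sym (*-distribˡ-+ c (f x) _))

∑-*ʳ : (c : ℕ) (xs : List A) (f : A → ℕ) → ∑[ x ← xs ] (f x * c) ≡ sumOver xs f * c
∑-*ʳ c [] f = refl
∑-*ʳ c (x ∷ xs) f = trans (cong (f x * c +_) (∑-*ʳ c xs f)) (sym (*-distribʳ-+ c (f x) _))

∑-comm : (xs : List A) (ys : List B) (h : A → B → ℕ) →
  ∑[ x ← xs ] ∑[ y ← ys ] h x y ≡ ∑[ y ← ys ] ∑[ x ← xs ] h x y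
∑-comm [] ys h = sym (∑-zero ys (λ _ → refl))
∑-comm (x ∷ xs) ys h =
  trans (cong (sumOver ys (h x) +_) (∑-comm xs ys h)) (sym (∑-+ ys (h x) _))

∑-map : (g : A → B) (xs : List A) (f : B → ℕ) → sumOver (map g xs) f ≡ ∑[ x ← xs ] f (g x)
∑-map g [] f = refl
∑-map g (x ∷ xs) f = cong (f (g x) +_) (∑-map g xs f)

∑-concatMap : (g : A → List B) (xs : List A) (f : B → ℕ) →
  sumOver (concatMap g xs) f ≡ ∑[ x ← xs ] sumOver (g x) f
∑-concatMap g [] f = refl
∑-concatMap g (x ∷ xs) f =
  trans (∑-++ (g x) (concatMap g xs) f) (cong (sumOver (g x) f +_) (∑-concatMap g xs f))

sum-map≡∑ : (f : A → ℕ) (xs : List A) → sum (map f xs) ≡ sumOver xs f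
sum-map≡∑ f [] = refl
sum-map≡∑ f (x ∷ xs) = cong (f x +_) (sum-map≡∑ f xs)

countB≡∑ : (p : A → Bool) (xs : List A) → countB p xs ≡ ∑[ x ← xs ] 𝟙 (p x)
countB≡∑ p [] = refl
countB≡∑ p (x ∷ xs) with p x
... | true = cong suc (countB≡∑ p xs)
... | false = countB≡∑ p xs

𝟙-∧ : (b c : Bool) → 𝟙 (b ∧ c) ≡ 𝟙 b * 𝟙 c
𝟙-∧ true c = sym (+-identityʳ (𝟙 c))
𝟙-∧ false c = refl

∑-lower : (xs : List A) (f : A → ℕ) → All (λ x → 1 ≤ f x) xs → length xs ≤ sumOver xs f
∑-lower [] f [] = z≤n
∑-lower (x ∷ xs) f (1≤fx ∷ 1≤f) = +-mono-≤ 1≤fx (∑-lower xs f 1≤f)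

∑-tight : (xs : List A) (f : A → ℕ) → All (λ x → 1 ≤ f x) xs → sumOver xs f ≡ length xs →
  All (λ x → f x ≡ 1) xs
∑-tight [] f [] _ = []
∑-tight (x ∷ xs) f (1≤fx ∷ 1≤f) sum≡ with f x in fx≡ | 1≤fx | sum≡
... | suc zero | _ | eq = fx≡ ∷ ∑-tight xs f 1≤f (suc-injective eq)
... | suc (suc k) | _ | eq =
  ⊥-elim (<⇒≱ (m<n+m (sumOver xs f) z<s) (subst (_≤ sumOver xs f) (sym (suc-injective eq)) (∑-lower xs f 1≤f)))

multiplicity : DecidableEquality A → A → List A → ℕ
multiplicity _≟ᴬ_ x xs = ∑[ y ← xs ] 𝟙 (does (y ≟ᴬ x))

∑-bijection : (_≟ᴬ_ : DecidableEquality A) (_≟ᴮ_ : DecidableEquality B)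
  (P : A → Bool) (Q : B → Bool) (f : A → B) (g : B → A) (xs : List A) (ys : List B) →
  (∀ x → P x ≡ true → Q (f x) ≡ true × g (f x) ≡ x × multiplicity _≟ᴮ_ (f x) ys ≡ 1) →
  (∀ y → Q y ≡ true → P (g y) ≡ true × f (g y) ≡ y × multiplicity _≟ᴬ_ (g y) xs ≡ 1) →
  ∑[ x ← xs ] 𝟙 (P x) ≡ ∑[ y ← ys ] 𝟙 (Q y)
∑-bijection _≟ᴬ_ _≟ᴮ_ P Q f g xs ys fwd bwd = begin
  ∑[ x ← xs ] 𝟙 (P x)
    ≡⟨ ∑-cong xs spreadP ⟩
  ∑[ x ← xs ] ∑[ y ← ys ] 𝟙 (P x) * 𝟙 (does (y ≟ᴮ f x))
    ≡⟨ ∑-cong xs (λ x → ∑-cong ys (matched x)) ⟩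
  ∑[ x ← xs ] ∑[ y ← ys ] 𝟙 (Q y) * 𝟙 (does (x ≟ᴬ g y))
    ≡⟨ ∑-comm xs ys _ ⟩
  ∑[ y ← ys ] ∑[ x ← xs ] 𝟙 (Q y) * 𝟙 (does (x ≟ᴬ g y))
    ≡⟨ ∑-cong ys spreadQ ⟨
  ∑[ y ← ys ] 𝟙 (Q y) ∎
  where
  open ≡-Reasoning
  true≢false : true ≢ false
  true≢false ()
  spreadP : ∀ x → 𝟙 (P x) ≡ ∑[ y ← ys ] 𝟙 (P x) * 𝟙 (does (y ≟ᴮ f x))
  spreadP x with P x in Px
  ... | true = trans (sym (proj₂ (proj₂ (fwd x Px)))) (∑-cong ys (λ y → sym (+-identityʳ _)))
  ... | false = sym (∑-zero ys (λ _ → refl))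
  spreadQ : ∀ y → 𝟙 (Q y) ≡ ∑[ x ← xs ] 𝟙 (Q y) * 𝟙 (does (x ≟ᴬ g y))
  spreadQ y with Q y in Qy
  ... | true = trans (sym (proj₂ (proj₂ (bwd y Qy)))) (∑-cong xs (λ x → sym (+-identityʳ _)))
  ... | false = sym (∑-zero xs (λ _ → refl))
  matched : ∀ x y → 𝟙 (P x) * 𝟙 (does (y ≟ᴮ f x)) ≡ 𝟙 (Q y) * 𝟙 (does (x ≟ᴬ g y))
  matched x y with P x in Px | Q y in Qy | y ≟ᴮ f x | x ≟ᴬ g y
  ... | true  | true  | yes _    | yes _    = refl
  ... | true  | _     | yes refl | no x≢gy  = ⊥-elim (x≢gy (sym (proj₁ (proj₂ (fwd x Px)))))
  ... | true  | false | yes refl | _        = ⊥-elim (true≢false (trans (sym (proj₁ (fwd x Px))) Qy))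
  ... | _     | true  | no y≢fx  | yes refl = ⊥-elim (y≢fx (sym (proj₁ (proj₂ (bwd y Qy)))))
  ... | false | true  | _        | yes refl = ⊥-elim (true≢false (trans (sym (proj₁ (bwd y Qy))) Px))
  ... | true  | true  | no _     | no _     = refl
  ... | true  | false | no _     | _        = refl
  ... | false | true  | _        | no _     = refl
  ... | false | false | _        | _        = refl

interval : ℕ → ℕ → List ℕ
interval s zero = []
interval s (suc n) = s ∷ interval (suc s) n

Between : ℕ → ℕ → ℕ → Set
Between s e m = s ≤ m × m < e

Between-empty : ∀ {s m} → ¬ Between s (s + 0) m
Between-empty {s} {m} (s≤m , m<s+0) = <⇒≱ m<s+0 (subst (_≤ m) (sym (+-identityʳ s)) s≤m)

Between-first : ∀ s l → Between s (s + suc l) s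
Between-first s l = ≤-refl , subst (s <_) (sym (+-suc s l)) (s≤s (m≤m+n s l))

Between-suc : ∀ {s l m} → Between (suc s) (suc s + l) m → Between s (s + suc l) m
Between-suc {s} {l} {m} (s<m , m<) = <⇒≤ s<m , subst (m <_) (sym (+-suc s l)) m<

Between-tighten : ∀ {s l m} → s < m → Between s (s + suc l) m → Between (suc s) (suc s + l) m
Between-tighten {s} {l} {m} s<m (_ , m<) = s<m , subst (m <_) (+-suc s l) m<

All-interval : {P : ℕ → Set} (s l : ℕ) → (∀ m → Between s (s + l) m → P m) → All P (interval s l)
All-interval s zero _ = []
All-interval s (suc l) p = p s (Between-first s l) ∷ All-interval (suc s) l (λ m → p m ∘ Between-suc)

interval-above : ∀ s l → All (s <_) (interval (suc s) l)
interval-above s l = All-interval (suc s) l (λ _ → proj₁)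

length-interval : ∀ s n → length (interval s n) ≡ n
length-interval s zero = refl
length-interval s (suc n) = cong suc (length-interval (suc s) n)

applyUpTo≡interval : ∀ {f : ℕ → ℕ} s n → (∀ i → f i ≡ s + i) → applyUpTo f n ≡ interval s n
applyUpTo≡interval s zero f≗s+ = refl
applyUpTo≡interval s (suc n) f≗s+ =
  cong₂ _∷_ (trans (f≗s+ 0) (+-identityʳ s))
            (applyUpTo≡interval (suc s) n (λ i → trans (f≗s+ (suc i)) (+-suc s i)))

range≡interval : ∀ n → range n ≡ interval 1 n
range≡interval n = trans (List.map-applyUpTo (λ i → i) suc n) (applyUpTo≡interval 1 n (λ i → refl))

length-range : ∀ n → length (range n) ≡ n
length-range n = trans (cong length (range≡interval n)) (length-interval 1 n)

∑-upTo-suc : ∀ n (f : ℕ → ℕ) → ∑[ i ← upTo (suc n) ] f i ≡ f 0 + ∑[ i ← upTo n ] f (suc i)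
∑-upTo-suc n f = cong (f 0 +_) (begin
  sumOver (applyUpTo suc n) f        ≡⟨ cong (λ l → sumOver l f) (List.map-applyUpTo (λ i → i) suc n) ⟨
  sumOver (map suc (upTo n)) f       ≡⟨ ∑-map suc (upTo n) f ⟩
  ∑[ i ← upTo n ] f (suc i)          ∎)
  where open ≡-Reasoning

multiplicity-interval-< : ∀ {m s} n → m < s → multiplicity _≟_ m (interval s n) ≡ 0
multiplicity-interval-< zero m<s = refl
multiplicity-interval-< {m} {s} (suc n) m<s
  rewrite dec-false (s ≟ m) (>⇒≢ m<s) = multiplicity-interval-< n (m<n⇒m<1+n m<s)

multiplicity-interval : ∀ {m s} n → Between s (s + n) m → multiplicity _≟_ m (interval s n) ≡ 1
multiplicity-interval zero m∈∅ = ⊥-elim (Between-empty m∈∅)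
multiplicity-interval {m} {s} (suc n) (s≤m , m<) with s ≟ m
... | yes refl = cong₂ (λ c r → 𝟙 c + r) (dec-true (m ≟ m) refl) (multiplicity-interval-< n ≤-refl)
... | no s≢m = trans (cong (λ c → 𝟙 c + multiplicity _≟_ m (interval (suc s) n)) (dec-false (s ≟ m) s≢m))
                     (multiplicity-interval n (Between-tighten (≤∧≢⇒< s≤m s≢m) (s≤m , m<)))

multiplicity-range : ∀ {m} n → Between 1 (1 + n) m → multiplicity _≟_ m (range n) ≡ 1
multiplicity-range {m} n m∈ =
  subst (λ l → multiplicity _≟_ m l ≡ 1) (sym (range≡interval n)) (multiplicity-interval n m∈)

_≟ᵛ_ : ∀ {n} → DecidableEquality (Vec ℕ n)
_≟ᵛ_ = Vec.≡-dec _≟_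

multiplicity-vecsOver : (xs : List ℕ) {n : ℕ} (v : Vec ℕ n) →
  All (λ e → multiplicity _≟_ e xs ≡ 1) (Vec.toList v) → multiplicity _≟ᵛ_ v (vecsOver xs n) ≡ 1
multiplicity-vecsOver xs Vec.[] [] = refl
multiplicity-vecsOver xs {suc n} (e Vec.∷ v) (once-e ∷ once-v) = begin
  multiplicity _≟ᵛ_ (e Vec.∷ v) (vecsOver xs (suc n))
    ≡⟨ ∑-concatMap (λ x → map (x Vec.∷_) (vecsOver xs n)) xs _ ⟩
  ∑[ x ← xs ] sumOver (map (x Vec.∷_) (vecsOver xs n)) (λ w → 𝟙 (does (w ≟ᵛ (e Vec.∷ v))))
    ≡⟨ ∑-cong xs (λ x → trans (∑-map (x Vec.∷_) (vecsOver xs n) _)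
                              (∑-cong (vecsOver xs n) (λ w → 𝟙-∧ (x ≡ᵇ e) _))) ⟩
  ∑[ x ← xs ] ∑[ w ← vecsOver xs n ] 𝟙 (x ≡ᵇ e) * 𝟙 (does (w ≟ᵛ v))
    ≡⟨ ∑-cong xs (λ x → ∑-*ˡ (𝟙 (x ≡ᵇ e)) (vecsOver xs n) _) ⟩
  ∑[ x ← xs ] 𝟙 (x ≡ᵇ e) * multiplicity _≟ᵛ_ v (vecsOver xs n)
    ≡⟨ ∑-cong xs (λ x → cong (𝟙 (x ≡ᵇ e) *_) (multiplicity-vecsOver xs v once-v)) ⟩
  ∑[ x ← xs ] 𝟙 (x ≡ᵇ e) * 1
    ≡⟨ ∑-cong xs (λ x → *-identityʳ _) ⟩
  multiplicity _≟_ e xs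
    ≡⟨ once-e ⟩
  1 ∎
  where open ≡-Reasoning

_≟ᶠ_ : ∀ {a b} → DecidableEquality (Filling a b)
mkFilling t u ≟ᶠ mkFilling t′ u′ =
  map′ (uncurry (cong₂ mkFilling)) (λ { refl → refl , refl }) ((t ≟ᵛ t′) ×-dec (u ≟ᵛ u′))

multiplicity-allFillings : (a b : ℕ) (t : Vec ℕ a) (u : Vec ℕ b) →
  multiplicity _≟ᵛ_ t (vecsOver (range (a + b)) a) ≡ 1 →
  multiplicity _≟ᵛ_ u (vecsOver (range (a + b)) b) ≡ 1 →
  multiplicity _≟ᶠ_ (mkFilling t u) (allFillings a b) ≡ 1
multiplicity-allFillings a b t u once-t once-u = begin
  multiplicity _≟ᶠ_ (mkFilling t u) (allFillings a b)
    ≡⟨ ∑-concatMap (λ t′ → map (mkFilling t′) (vecs b)) (vecs a) _ ⟩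
  ∑[ t′ ← vecs a ] sumOver (map (mkFilling t′) (vecs b)) (λ f → 𝟙 (does (f ≟ᶠ mkFilling t u)))
    ≡⟨ ∑-cong (vecs a) (λ t′ → trans (∑-map (mkFilling t′) (vecs b) _)
                                    (∑-cong (vecs b) (λ u′ → 𝟙-∧ (does (t′ ≟ᵛ t)) _))) ⟩
  ∑[ t′ ← vecs a ] ∑[ u′ ← vecs b ] 𝟙 (does (t′ ≟ᵛ t)) * 𝟙 (does (u′ ≟ᵛ u))
    ≡⟨ ∑-cong (vecs a) (λ t′ → ∑-*ˡ (𝟙 (does (t′ ≟ᵛ t))) (vecs b) _) ⟩
  ∑[ t′ ← vecs a ] 𝟙 (does (t′ ≟ᵛ t)) * multiplicity _≟ᵛ_ u (vecs b)
    ≡⟨ ∑-*ʳ (multiplicity _≟ᵛ_ u (vecs b)) (vecs a) _ ⟩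
  multiplicity _≟ᵛ_ t (vecs a) * multiplicity _≟ᵛ_ u (vecs b)
    ≡⟨ cong₂ _*_ once-t once-u ⟩
  1 ∎
  where
  open ≡-Reasoning
  vecs : (n : ℕ) → List (Vec ℕ n)
  vecs = vecsOver (range (a + b))

∑-allPaths-suc : ∀ m (F : List Bool → ℕ) →
  sumOver (allPaths (suc m)) F ≡ ∑[ p ← allPaths m ] F (true ∷ p) + ∑[ p ← allPaths m ] F (false ∷ p)
∑-allPaths-suc m F =
  trans (∑-concatMap (λ s → map (s ∷_) (allPaths m)) (true ∷ false ∷ []) F)
        (cong₂ _+_ (∑-map (true ∷_) (allPaths m) F) (trans (+-identityʳ _) (∑-map (false ∷_) (allPaths m) F)))

_≟ʷ_ : DecidableEquality (List Bool)
_≟ʷ_ = List.≡-dec Bool._≟_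

multiplicity-allPaths : ∀ n (w : List Bool) → length w ≡ n → multiplicity _≟ʷ_ w (allPaths n) ≡ 1
multiplicity-allPaths zero [] refl = refl
multiplicity-allPaths (suc n) (c ∷ w) refl =
  trans (∑-allPaths-suc n (λ p → 𝟙 (does (p ≟ʷ (c ∷ w))))) (first-letter c)
  where
  first-letter : ∀ c → ∑[ p ← allPaths n ] 𝟙 (does (true Bool.≟ c) ∧ does (p ≟ʷ w))
                     + ∑[ p ← allPaths n ] 𝟙 (does (false Bool.≟ c) ∧ does (p ≟ʷ w)) ≡ 1
  first-letter true = cong₂ _+_ (multiplicity-allPaths n w refl) (∑-zero (allPaths n) (λ _ → refl))
  first-letter false = cong₂ _+_ (∑-zero (allPaths n) (λ _ → refl)) (multiplicity-allPaths n w refl)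

allPaths-length : ∀ n → All (λ p → length p ≡ n) (allPaths n)
allPaths-length zero = refl ∷ []
allPaths-length (suc n) = ++⁺ (extend true) (++⁺ (extend false) [])
  where
  extend : ∀ s → All (λ p → length p ≡ suc n) (map (s ∷_) (allPaths n))
  extend s = map⁺ (All.map (cong suc) (allPaths-length n))

-- Fillings as lattice words

∧-true⁻ : ∀ {x y} → x ∧ y ≡ true → x ≡ true × y ≡ true
∧-true⁻ {true} {true} refl = refl , refl

∧-true⁺ : ∀ {x y} → x ≡ true → y ≡ true → x ∧ y ≡ true
∧-true⁺ refl refl = refl

all-true⁻ : (p : A → Bool) (xs : List A) → all p xs ≡ true → All (λ x → p x ≡ true) xs
all-true⁻ p [] _ = []
all-true⁻ p (x ∷ xs) e = proj₁ (∧-true⁻ e) ∷ all-true⁻ p xs (proj₂ (∧-true⁻ e))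

all-true⁺ : (p : A → Bool) {xs : List A} → All (λ x → p x ≡ true) xs → all p xs ≡ true
all-true⁺ p [] = refl
all-true⁺ p (px ∷ pxs) = ∧-true⁺ px (all-true⁺ p pxs)

does-≟-true : ∀ c → does (c Bool.≟ true) ≡ c
does-≟-true true = refl
does-≟-true false = refl

does-≟-false : ∀ c → does (c Bool.≟ false) ≡ not c
does-≟-false true = refl
does-≟-false false = refl

𝟙-∨ : ∀ x y → x ∨ y ≡ true → 1 ≤ 𝟙 x + 𝟙 y
𝟙-∨ true y _ = s≤s z≤n
𝟙-∨ false true _ = s≤s z≤n

𝟙+𝟙≡1 : ∀ x y → 𝟙 x + 𝟙 y ≡ 1 → not x ≡ y
𝟙+𝟙≡1 true false _ = refl
𝟙+𝟙≡1 false true _ = refl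

if-true : ∀ {c} {x y : A} → c ≡ true → (if c then x else y) ≡ x
if-true refl = refl

if-false : ∀ {c} {x y : A} → c ≡ false → (if c then x else y) ≡ y
if-false refl = refl

≡true⇒T : ∀ {c} → c ≡ true → T c
≡true⇒T refl = _

elemB-here : ∀ m L → elemB m (m ∷ L) ≡ true
elemB-here m L = cong (_∨ elemB m L) (dec-true (m ≟ m) refl)

elemB-skip : ∀ {m x} L → m ≢ x → elemB m (x ∷ L) ≡ elemB m L
elemB-skip {m} {x} L m≢x = cong (_∨ elemB m L) (dec-false (m ≟ x) m≢x)

elemB-absent : ∀ {m} L → All (m ≢_) L → elemB m L ≡ false
elemB-absent [] [] = refl
elemB-absent (x ∷ L) (m≢x ∷ m∉L) = trans (elemB-skip L m≢x) (elemB-absent L m∉L)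

elemB-++ : ∀ m xs ys → elemB m (xs ++ ys) ≡ elemB m xs ∨ elemB m ys
elemB-++ m [] ys = refl
elemB-++ m (x ∷ xs) ys = trans (cong ((m ≡ᵇ x) ∨_) (elemB-++ m xs ys)) (sym (∨-assoc (m ≡ᵇ x) _ _))

elemB-All : ∀ {P : ℕ → Set} {m} L → elemB m L ≡ true → All P L → P m
elemB-All {m = m} (x ∷ L) e (px ∷ pL) with m ≟ x
... | yes refl = px
... | no m≢x = elemB-All L (trans (sym (elemB-skip L m≢x)) e) pL

increasing-∷⁻ : ∀ x L → strictlyIncreasing (x ∷ L) ≡ true → All (x <_) L × strictlyIncreasing L ≡ true
increasing-∷⁻ x [] _ = [] , refl
increasing-∷⁻ x (y ∷ L) e with ∧-true⁻ {x <ᵇ y} e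
... | x<ᵇy , incr-yL = x<y ∷ All.map (<-trans x<y) (proj₁ (increasing-∷⁻ y L incr-yL)) , incr-yL
  where x<y = <ᵇ⇒< x y (≡true⇒T x<ᵇy)

increasing-∷⁺ : ∀ x L → strictlyIncreasing L ≡ true → All (x <_) L → strictlyIncreasing (x ∷ L) ≡ true
increasing-∷⁺ x [] _ _ = refl
increasing-∷⁺ x (y ∷ L) incr (x<y ∷ _) = ∧-true⁺ (dec-true (x <? y) x<y) incr

positions : Bool → ℕ → List Bool → List ℕ
positions b s [] = []
positions b s (c ∷ w) = if does (c Bool.≟ b) then s ∷ positions b (suc s) w else positions b (suc s) w

occurrences : Bool → List Bool → ℕ
occurrences b [] = 0
occurrences b (c ∷ w) = if does (c Bool.≟ b) then suc (occurrences b w) else occurrences b w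

length-positions : ∀ b s w → length (positions b s w) ≡ occurrences b w
length-positions b s [] = refl
length-positions b s (c ∷ w) with c Bool.≟ b
... | yes _ = cong suc (length-positions b (suc s) w)
... | no _ = length-positions b (suc s) w

occurrences-true+false : ∀ w → occurrences true w + occurrences false w ≡ length w
occurrences-true+false [] = refl
occurrences-true+false (true ∷ w) = cong suc (occurrences-true+false w)
occurrences-true+false (false ∷ w) =
  trans (+-suc (occurrences true w) (occurrences false w)) (cong suc (occurrences-true+false w))

occurrences-true-map : (h : A → Bool) (xs : List A) → occurrences true (map h xs) ≡ ∑[ x ← xs ] 𝟙 (h x)
occurrences-true-map h [] = refl
occurrences-true-map h (x ∷ xs) with h x
... | true = cong suc (occurrences-true-map h xs)
... | false = occurrences-true-map h xs

positions-bounded : ∀ b s w → All (Between s (s + length w)) (positions b s w)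
positions-bounded b s [] = []
positions-bounded b s (c ∷ w) with c Bool.≟ b
... | yes _ = Between-first s (length w) ∷ All.map Between-suc (positions-bounded b (suc s) w)
... | no _ = All.map Between-suc (positions-bounded b (suc s) w)

positions-above : ∀ b s w → All (s <_) (positions b (suc s) w)
positions-above b s w = All.map proj₁ (positions-bounded b (suc s) w)

positions-increasing : ∀ b s w → strictlyIncreasing (positions b s w) ≡ true
positions-increasing b s [] = refl
positions-increasing b s (c ∷ w) with c Bool.≟ b
... | yes _ = increasing-∷⁺ s _ (positions-increasing b (suc s) w) (positions-above b s w)
... | no _ = positions-increasing b (suc s) w

positions-disjoint : ∀ s w m → elemB m (positions true s w) ≡ true → elemB m (positions false s w) ≡ false
positions-disjoint s (true ∷ w) m m∈T with m ≟ s
... | yes refl = elemB-absent (positions false (suc m) w) (All.map <⇒≢ (positions-above false m w))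
... | no m≢s = positions-disjoint (suc s) w m (trans (sym (elemB-skip (positions true (suc s) w) m≢s)) m∈T)
positions-disjoint s (false ∷ w) m m∈T =
  trans (elemB-skip (positions false (suc s) w) m≢s) (positions-disjoint (suc s) w m m∈T)
  where
  m≢s : m ≢ s
  m≢s = >⇒≢ (elemB-All _ m∈T (positions-above true s w))

positions-cover : ∀ s w m → Between s (s + length w) m →
  elemB m (positions true s w) ∨ elemB m (positions false s w) ≡ true
positions-cover s [] m m∈∅ = ⊥-elim (Between-empty m∈∅)
positions-cover s (c ∷ w) m (s≤m , m<) with m≤n⇒m<n∨m≡n s≤m | c
... | inj₂ refl | true = cong (_∨ elemB m (positions false (suc m) w)) (elemB-here m (positions true (suc m) w))
... | inj₂ refl | false =
  trans (cong (elemB m (positions true (suc m) w) ∨_) (elemB-here m (positions false (suc m) w))) (∨-zeroʳ _)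
... | inj₁ s<m | true =
  trans (cong (_∨ elemB m (positions false (suc s) w)) (elemB-skip (positions true (suc s) w) (>⇒≢ s<m)))
        (positions-cover (suc s) w m (s<m , subst (m <_) (+-suc s _) m<))
... | inj₁ s<m | false =
  trans (cong (elemB m (positions true (suc s) w) ∨_) (elemB-skip (positions false (suc s) w) (>⇒≢ s<m)))
        (positions-cover (suc s) w m (s<m , subst (m <_) (+-suc s _) m<))

indicator-positions : ∀ s w → map (λ m → elemB m (positions true s w)) (interval s (length w)) ≡ w
indicator-positions s [] = refl
indicator-positions s (true ∷ w) = cong₂ _∷_ (elemB-here s (positions true (suc s) w)) (begin
  map (λ m → elemB m (s ∷ positions true (suc s) w)) (interval (suc s) (length w))
    ≡⟨ List.map-cong-local
         (All-interval (suc s) (length w) (λ m (s<m , _) → elemB-skip (positions true (suc s) w) (>⇒≢ s<m))) ⟩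
  map (λ m → elemB m (positions true (suc s) w)) (interval (suc s) (length w))
    ≡⟨ indicator-positions (suc s) w ⟩
  w ∎)
  where open ≡-Reasoning
indicator-positions s (false ∷ w) =
  cong₂ _∷_ (elemB-absent (positions true (suc s) w) (All.map <⇒≢ (positions-above true s w)))
            (indicator-positions (suc s) w)

positions-indicator : ∀ b (h : ℕ → Bool) s l L → strictlyIncreasing L ≡ true → All (Between s (s + l)) L →
  All (λ m → does (h m Bool.≟ b) ≡ elemB m L) (interval s l) →
  positions b s (map h (interval s l)) ≡ L
positions-indicator b h s zero [] _ _ _ = refl
positions-indicator b h s zero (x ∷ L) _ (x∈∅ ∷ _) _ = ⊥-elim (Between-empty x∈∅)
positions-indicator b h s (suc l) [] _ _ (agree-s ∷ agree) =
  trans (if-false agree-s) (positions-indicator b h (suc s) l [] refl [] agree)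
positions-indicator b h s (suc l) (x ∷ L′) incr ((s≤x , x<) ∷ bounded′) (agree-s ∷ agree)
  with m≤n⇒m<n∨m≡n s≤x | increasing-∷⁻ x L′ incr
... | inj₂ refl | s<L′ , incr′ =
  trans (if-true (trans agree-s (elemB-here s L′)))
        (cong (s ∷_) (positions-indicator b h (suc s) l L′ incr′
          (All.zipWith (uncurry Between-tighten) (s<L′ , bounded′))
          (All.zipWith (λ (e , s<m) → trans e (elemB-skip L′ (>⇒≢ s<m))) (agree , interval-above s l))))
... | inj₁ s<x | x<L′ , incr′ =
  trans (if-false (trans agree-s (elemB-absent (x ∷ L′) (All.map <⇒≢ s<xL′))))
        (positions-indicator b h (suc s) l (x ∷ L′) incr
          (All.zipWith (uncurry Between-tighten) (s<xL′ , (s≤x , x<) ∷ bounded′)) agree)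
  where
  s<xL′ : All (s <_) (x ∷ L′)
  s<xL′ = s<x ∷ All.map (<-trans s<x) x<L′

indicatorWord : ℕ → List ℕ → List Bool
indicatorWord n L = map (λ m → elemB m L) (range n)

positions-indicatorWord : ∀ n L → strictlyIncreasing L ≡ true → All (Between 1 (1 + n)) L →
  positions true 1 (indicatorWord n L) ≡ L
positions-indicatorWord n L incr bounded rewrite range≡interval n =
  positions-indicator true (λ m → elemB m L) 1 n L incr bounded (All.universal (λ m → does-≟-true (elemB m L)) _)

record ValidRows (a b : ℕ) (T U : List ℕ) : Set where
  field
    increasingᵀ : strictlyIncreasing T ≡ true
    increasingᵁ : strictlyIncreasing U ≡ true
    boundedᵀ : All (Between 1 (1 + (a + b))) T
    boundedᵁ : All (Between 1 (1 + (a + b))) U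
    covering : All (λ m → elemB m T ∨ elemB m U ≡ true) (range (a + b))
    lengthᵀ : length T ≡ a
    lengthᵁ : length U ≡ b

module _ {a b : ℕ} {T U : List ℕ} (rows : ValidRows a b T U) where
  open ValidRows rows

  private
    count-members : ∀ L → strictlyIncreasing L ≡ true → All (Between 1 (1 + (a + b))) L →
      ∑[ m ← range (a + b) ] 𝟙 (elemB m L) ≡ length L
    count-members L incr bounded = begin
      ∑[ m ← range (a + b) ] 𝟙 (elemB m L)
        ≡⟨ occurrences-true-map (λ m → elemB m L) (range (a + b)) ⟨
      occurrences true (indicatorWord (a + b) L)
        ≡⟨ length-positions true 1 (indicatorWord (a + b) L) ⟨
      length (positions true 1 (indicatorWord (a + b) L))
        ≡⟨ cong length (positions-indicatorWord (a + b) L incr bounded) ⟩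
      length L ∎
      where open ≡-Reasoning

  rows-complement : All (λ m → not (elemB m T) ≡ elemB m U) (range (a + b))
  rows-complement = All.map (λ {m} → 𝟙+𝟙≡1 (elemB m T) (elemB m U))
    (∑-tight (range (a + b)) (λ m → 𝟙 (elemB m T) + 𝟙 (elemB m U))
      (All.map (λ {m} → 𝟙-∨ (elemB m T) (elemB m U)) covering)
      (begin
        ∑[ m ← range (a + b) ] (𝟙 (elemB m T) + 𝟙 (elemB m U))
          ≡⟨ ∑-+ (range (a + b)) (λ m → 𝟙 (elemB m T)) (λ m → 𝟙 (elemB m U)) ⟩
        ∑[ m ← range (a + b) ] 𝟙 (elemB m T) + ∑[ m ← range (a + b) ] 𝟙 (elemB m U)
          ≡⟨ cong₂ _+_ (count-members T increasingᵀ boundedᵀ) (count-members U increasingᵁ boundedᵁ) ⟩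
        length T + length U
          ≡⟨ cong₂ _+_ lengthᵀ lengthᵁ ⟩
        a + b
          ≡⟨ length-range (a + b) ⟨
        length (range (a + b)) ∎))
    where open ≡-Reasoning

  rows-top : positions true 1 (indicatorWord (a + b) T) ≡ T
  rows-top = positions-indicatorWord (a + b) T increasingᵀ boundedᵀ

  rows-bottom : positions false 1 (indicatorWord (a + b) T) ≡ U
  rows-bottom rewrite range≡interval (a + b) =
    positions-indicator false (λ m → elemB m T) 1 (a + b) U increasingᵁ boundedᵁ
      (All.map (λ {m} e → trans (does-≟-false (elemB m T)) e) (subst (All _) (range≡interval (a + b)) rows-complement))

-- Pads with zeros or truncates; only ever applied to lists of length n.
toVec : (n : ℕ) → List ℕ → Vec ℕ n
toVec zero _ = Vec.[]
toVec (suc n) [] = 0 Vec.∷ toVec n []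
toVec (suc n) (x ∷ l) = x Vec.∷ toVec n l

toVec-toList : ∀ {n} (v : Vec ℕ n) → toVec n (Vec.toList v) ≡ v
toVec-toList Vec.[] = refl
toVec-toList (x Vec.∷ v) = cong (x Vec.∷_) (toVec-toList v)

toList-toVec : ∀ {n} l → length l ≡ n → Vec.toList (toVec n l) ≡ l
toList-toVec [] refl = refl
toList-toVec (x ∷ l) refl = cong (x ∷_) (toList-toVec l refl)

endsAt : (a b x y : ℕ) → List Bool → Bool
endsAt a b x y [] = (x ≡ᵇ a) ∧ (y ≡ᵇ b)
endsAt a b x y (true ∷ p) = endsAt a b (suc x) y p
endsAt a b x y (false ∷ p) = endsAt a b x (suc y) p

endsAt⁻ : ∀ a b x y p → endsAt a b x y p ≡ true → x + occurrences true p ≡ a × y + occurrences false p ≡ b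
endsAt⁻ a b x y [] e =
  trans (+-identityʳ x) (≡ᵇ⇒≡ x a (≡true⇒T (proj₁ (∧-true⁻ e)))) ,
  trans (+-identityʳ y) (≡ᵇ⇒≡ y b (≡true⇒T (proj₂ (∧-true⁻ e))))
endsAt⁻ a b x y (true ∷ p) e with endsAt⁻ a b (suc x) y p e
... | x+ , y+ = trans (+-suc x _) x+ , y+
endsAt⁻ a b x y (false ∷ p) e with endsAt⁻ a b x (suc y) p e
... | x+ , y+ = x+ , trans (+-suc y _) y+

endsAt⁺ : ∀ a b x y p → x + occurrences true p ≡ a → y + occurrences false p ≡ b → endsAt a b x y p ≡ true
endsAt⁺ a b x y [] x+ y+ =
  ∧-true⁺ (dec-true (x ≟ a) (trans (sym (+-identityʳ x)) x+)) (dec-true (y ≟ b) (trans (sym (+-identityʳ y)) y+))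
endsAt⁺ a b x y (true ∷ p) x+ y+ = endsAt⁺ a b (suc x) y p (trans (sym (+-suc x _)) x+) y+
endsAt⁺ a b x y (false ∷ p) x+ y+ = endsAt⁺ a b x (suc y) p x+ (trans (sym (+-suc y _)) y+)

module _ (a b : ℕ) where

  fillingOf : List Bool → Filling a b
  fillingOf w = mkFilling (toVec a (positions true 1 w)) (toVec b (positions false 1 w))

  wordOf : Filling a b → List Bool
  wordOf f = indicatorWord (a + b) (Vec.toList (top f))

  inRangeᵇ : ℕ → Bool
  inRangeᵇ x = (1 ≤ᵇ x) ∧ (x ≤ᵇ a + b)

  inRangeᵇ⇒Between : ∀ {x} → inRangeᵇ x ≡ true → Between 1 (1 + (a + b)) x
  inRangeᵇ⇒Between {x} e with ∧-true⁻ {1 ≤ᵇ x} e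
  ... | 1≤x , x≤n = ≤ᵇ⇒≤ 1 x (≡true⇒T 1≤x) , s≤s (≤ᵇ⇒≤ x (a + b) (≡true⇒T x≤n))

  Between⇒inRangeᵇ : ∀ {x} → Between 1 (1 + (a + b)) x → inRangeᵇ x ≡ true
  Between⇒inRangeᵇ {x} (1≤x , s≤s x≤n) = ∧-true⁺ (dec-true (1 ≤? x) 1≤x) (dec-true (x ≤? a + b) x≤n)

  isFilling⇒ValidRows : ∀ f → isFilling f ≡ true → ValidRows a b (Vec.toList (top f)) (Vec.toList (bottom f))
  isFilling⇒ValidRows (mkFilling t u) valid
    with ∧-true⁻ {strictlyIncreasing (Vec.toList t)} valid
  ... | incrᵀ , valid′ with ∧-true⁻ {strictlyIncreasing (Vec.toList u)} valid′
  ... | incrᵁ , valid″ with ∧-true⁻ {all inRangeᵇ (Vec.toList t ++ Vec.toList u)} valid″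
  ... | in-range , covered = record
    { increasingᵀ = incrᵀ
    ; increasingᵁ = incrᵁ
    ; boundedᵀ = proj₁ bounded
    ; boundedᵁ = proj₂ bounded
    ; covering = All.map (λ {m} e → trans (sym (elemB-++ m (Vec.toList t) (Vec.toList u))) e)
                         (all-true⁻ _ (range (a + b)) covered)
    ; lengthᵀ = Vec.length-toList t
    ; lengthᵁ = Vec.length-toList u
    }
    where
    bounded = ++⁻ (Vec.toList t)
                  (All.map inRangeᵇ⇒Between (all-true⁻ inRangeᵇ (Vec.toList t ++ Vec.toList u) in-range))

  ValidRows⇒isFilling : (t : Vec ℕ a) (u : Vec ℕ b) → ValidRows a b (Vec.toList t) (Vec.toList u) →
    isFilling (mkFilling t u) ≡ true
  ValidRows⇒isFilling t u rows = ∧-true⁺ increasingᵀ (∧-true⁺ increasingᵁ (∧-true⁺ in-range covered))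
    where
    open ValidRows rows
    in-range : all inRangeᵇ (Vec.toList t ++ Vec.toList u) ≡ true
    in-range = all-true⁺ inRangeᵇ (All.map Between⇒inRangeᵇ (++⁺ boundedᵀ boundedᵁ))
    covered : all (λ m → elemB m (Vec.toList t ++ Vec.toList u)) (range (a + b)) ≡ true
    covered = all-true⁺ _ (All.map (λ {m} e → trans (elemB-++ m (Vec.toList t) (Vec.toList u)) e) covering)

  module _ (w : List Bool) (ends : endsAt a b 0 0 w ≡ true) where

    private
      counts = endsAt⁻ a b 0 0 w ends

      lengthᵀ : length (positions true 1 w) ≡ a
      lengthᵀ = trans (length-positions true 1 w) (proj₁ counts)

      lengthᵁ : length (positions false 1 w) ≡ b
      lengthᵁ = trans (length-positions false 1 w) (proj₂ counts)

      length-word : length w ≡ a + b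
      length-word = trans (sym (occurrences-true+false w)) (cong₂ _+_ (proj₁ counts) (proj₂ counts))

      range≡interval-word : range (a + b) ≡ interval 1 (length w)
      range≡interval-word = trans (range≡interval (a + b)) (cong (interval 1) (sym length-word))

      bounded : ∀ c → All (Between 1 (1 + (a + b))) (positions c 1 w)
      bounded c = subst (λ n → All (Between 1 (1 + n)) (positions c 1 w)) length-word (positions-bounded c 1 w)

      word-rows : ValidRows a b (positions true 1 w) (positions false 1 w)
      word-rows = record
        { increasingᵀ = positions-increasing true 1 w
        ; increasingᵁ = positions-increasing false 1 w
        ; boundedᵀ = bounded true
        ; boundedᵁ = bounded false
        ; covering = subst (All _) (sym range≡interval-word) (All-interval 1 (length w) (positions-cover 1 w))
        ; lengthᵀ = lengthᵀ
        ; lengthᵁ = lengthᵁ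
        }

    top-fillingOf : Vec.toList (top (fillingOf w)) ≡ positions true 1 w
    top-fillingOf = toList-toVec (positions true 1 w) lengthᵀ

    bottom-fillingOf : Vec.toList (bottom (fillingOf w)) ≡ positions false 1 w
    bottom-fillingOf = toList-toVec (positions false 1 w) lengthᵁ

    wordOf-fillingOf : wordOf (fillingOf w) ≡ w
    wordOf-fillingOf = begin
      map (λ m → elemB m (Vec.toList (top (fillingOf w)))) (range (a + b))
        ≡⟨ cong₂ (λ L r → map (λ m → elemB m L) r) top-fillingOf range≡interval-word ⟩
      map (λ m → elemB m (positions true 1 w)) (interval 1 (length w))
        ≡⟨ indicator-positions 1 w ⟩
      w ∎
      where open ≡-Reasoning

    isFilling-fillingOf : isFilling (fillingOf w) ≡ true
    isFilling-fillingOf =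
      ValidRows⇒isFilling _ _ (subst₂ (ValidRows a b) (sym top-fillingOf) (sym bottom-fillingOf) word-rows)

    multiplicity-fillingOf : multiplicity _≟ᶠ_ (fillingOf w) (allFillings a b) ≡ 1
    multiplicity-fillingOf =
      multiplicity-allFillings a b _ _ (once top-fillingOf (bounded true)) (once bottom-fillingOf (bounded false))
      where
      once : ∀ {n} {v : Vec ℕ n} {L} → Vec.toList v ≡ L → All (Between 1 (1 + (a + b))) L →
        multiplicity _≟ᵛ_ v (vecsOver (range (a + b)) n) ≡ 1
      once {v = v} refl bounded-v = multiplicity-vecsOver (range (a + b)) v (All.map (multiplicity-range (a + b)) bounded-v)

  module _ (f : Filling a b) (valid : isFilling f ≡ true) where

    private
      rows = isFilling⇒ValidRows f valid

    fillingOf-wordOf : fillingOf (wordOf f) ≡ f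
    fillingOf-wordOf = cong₂ mkFilling
      (trans (cong (toVec a) (rows-top rows)) (toVec-toList (top f)))
      (trans (cong (toVec b) (rows-bottom rows)) (toVec-toList (bottom f)))

    endsAt-wordOf : endsAt a b 0 0 (wordOf f) ≡ true
    endsAt-wordOf = endsAt⁺ a b 0 0 (wordOf f)
      (trans (sym (length-positions true 1 (wordOf f))) (trans (cong length (rows-top rows)) (ValidRows.lengthᵀ rows)))
      (trans (sym (length-positions false 1 (wordOf f))) (trans (cong length (rows-bottom rows)) (ValidRows.lengthᵁ rows)))

    multiplicity-wordOf : multiplicity _≟ʷ_ (wordOf f) (allPaths (a + b)) ≡ 1
    multiplicity-wordOf =
      multiplicity-allPaths (a + b) (wordOf f) (trans (List.length-map _ (range (a + b))) (length-range (a + b)))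

  cardS≡∑-words : ∀ k →
    cardS a b k ≡ ∑[ w ← allPaths (a + b) ] 𝟙 (endsAt a b 0 0 w ∧ (inversions (fillingOf w) ≡ᵇ k))
  cardS≡∑-words k = trans (countB≡∑ _ (allFillings a b))
    (∑-bijection _≟ᶠ_ _≟ʷ_ _ _ wordOf fillingOf (allFillings a b) (allPaths (a + b)) forward backward)
    where
    forward : ∀ f → isFilling f ∧ (inversions f ≡ᵇ k) ≡ true →
      endsAt a b 0 0 (wordOf f) ∧ (inversions (fillingOf (wordOf f)) ≡ᵇ k) ≡ true ×
      fillingOf (wordOf f) ≡ f × multiplicity _≟ʷ_ (wordOf f) (allPaths (a + b)) ≡ 1
    forward f Pf with ∧-true⁻ {isFilling f} Pf
    ... | valid , inv≡k =
      ∧-true⁺ (endsAt-wordOf f valid)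
              (subst (λ g → (inversions g ≡ᵇ k) ≡ true) (sym (fillingOf-wordOf f valid)) inv≡k) ,
      fillingOf-wordOf f valid , multiplicity-wordOf f valid
    backward : ∀ w → endsAt a b 0 0 w ∧ (inversions (fillingOf w) ≡ᵇ k) ≡ true →
      isFilling (fillingOf w) ∧ (inversions (fillingOf w) ≡ᵇ k) ≡ true ×
      wordOf (fillingOf w) ≡ w × multiplicity _≟ᶠ_ (fillingOf w) (allFillings a b) ≡ 1
    backward w Qw with ∧-true⁻ {endsAt a b 0 0 w} Qw
    ... | ends , inv≡k =
      ∧-true⁺ (isFilling-fillingOf w ends) inv≡k , wordOf-fillingOf w ends , multiplicity-fillingOf w ends

-- Inversions as changes along the path

-- The number of adjacent unequal entries in  c ∷ bs ++ [ false ]  (in  bs ++ [ false ]  for nothing).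
changes : Maybe Bool → List Bool → ℕ
changes nothing [] = 0
changes (just c) [] = 𝟙 c
changes nothing (b ∷ bs) = changes (just b) bs
changes (just c) (b ∷ bs) = 𝟙 (c xor b) + changes (just b) bs

northAbove : List Bool → ℕ → ℕ → List Bool
northAbove [] x y = []
northAbove (true ∷ p) x y = northAbove p (suc x) y
northAbove (false ∷ p) x y = (x ≤ᵇ y) ∷ northAbove p x (suc y)

columnBits : List ℕ → List ℕ → List Bool
columnBits us ts = zipWith _<ᵇ_ us ts

DistinctAt : List ℕ → List ℕ → ℕ → Set
DistinctAt ts us c = ∀ x → entry ts c ≡ just x → entry us c ≢ just x

ColumnsDistinct : List ℕ → List ℕ → Set
ColumnsDistinct ts us = ∀ c → DistinctAt ts us c

scanResult : Maybe ℕ → Maybe ℕ → Bool → Bool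
scanResult (just x) (just y) iBelow = y <ᵇ x
scanResult _ _ iBelow = iBelow

-- No value occurs in both rows, so the scan never meets i_k = j_k and stops after one step.
scan-distinct : ∀ fuel ri rj c iBelow → DistinctAt ri rj c →
  scan (suc fuel) ri rj c iBelow ≡ scanResult (entry ri c) (entry rj c) iBelow
scan-distinct fuel ri rj c iBelow distinct with entry ri c | entry rj c
... | just x | just y with y <ᵇ x
...   | true = refl
...   | false = cong (λ z → if z then scan fuel ri rj (suc c) iBelow else false)
                     (dec-false (x ≟ y) λ { refl → distinct x refl refl })
scan-distinct fuel ri rj c iBelow distinct | just x | nothing = refl
scan-distinct fuel ri rj c iBelow distinct | nothing | _ = refl

columnResult : Maybe ℕ → Maybe ℕ → Maybe ℕ → Maybe ℕ → Bool
columnResult _ nothing _ _ = false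
columnResult nothing (just _) _ _ = false
columnResult (just t) (just u) t₁ u₁ = if u <ᵇ t then scanResult u₁ t₁ true else scanResult t₁ u₁ false

columnResultAt : List ℕ → List ℕ → ℕ → Bool
columnResultAt ts us c = columnResult (entry ts c) (entry us c) (entry ts (suc c)) (entry us (suc c))

columnInversion-distinct : ∀ {a b} (f : Filling a b) c → ColumnsDistinct (Vec.toList (top f)) (Vec.toList (bottom f)) →
  columnInversion f c ≡ columnResultAt (Vec.toList (top f)) (Vec.toList (bottom f)) c
columnInversion-distinct {a} {b} f c distinct with entry (Vec.toList (top f)) c | entry (Vec.toList (bottom f)) c
... | just t | just u with u <ᵇ t
...   | true = scan-distinct (a + b) (Vec.toList (bottom f)) (Vec.toList (top f)) (suc c) true
                 (λ x eᵤ eₜ → distinct (suc c) x eₜ eᵤ)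
...   | false = scan-distinct (a + b) (Vec.toList (top f)) (Vec.toList (bottom f)) (suc c) false (distinct (suc c))
columnInversion-distinct f c distinct | just _ | nothing = refl
columnInversion-distinct f c distinct | nothing | just _ = refl
columnInversion-distinct f c distinct | nothing | nothing = refl

<ᵇ-flip : ∀ {m n} → m ≢ n → (n <ᵇ m) ≡ not (m <ᵇ n)
<ᵇ-flip {m} {n} m≢n with <-cmp m n
... | tri< m<n _ _ = trans (dec-false (n <? m) (<⇒≯ m<n)) (cong not (sym (dec-true (m <? n) m<n)))
... | tri≈ _ m≡n _ = ⊥-elim (m≢n m≡n)
... | tri> _ _ n<m = trans (dec-true (n <? m) n<m) (cong not (sym (dec-false (m <? n) (<⇒≯ n<m))))

columnResultAt-head : ∀ t u ts us → length us ≤ length ts → DistinctAt ts us 0 →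
  𝟙 (columnResultAt (t ∷ ts) (u ∷ us) 0) + changes nothing (columnBits us ts)
    ≡ changes (just (u <ᵇ t)) (columnBits us ts)
columnResultAt-head t u [] [] _ _ with u <ᵇ t
... | true = refl
... | false = refl
columnResultAt-head t u (_ ∷ _) [] _ _ with u <ᵇ t
... | true = refl
... | false = refl
columnResultAt-head t u (t′ ∷ ts) (u′ ∷ us) _ distinct with u <ᵇ t
... | true = cong (λ z → 𝟙 z + changes (just (u′ <ᵇ t′)) (columnBits us ts))
                  (<ᵇ-flip {u′} {t′} (λ { refl → distinct u′ refl refl }))
... | false = refl

∑-columnResultAt : ∀ ts us → length us ≤ length ts → ColumnsDistinct ts us →
  ∑[ c ← upTo (length ts) ] 𝟙 (columnResultAt ts us c) ≡ changes nothing (columnBits us ts)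
∑-columnResultAt [] [] _ _ = refl
∑-columnResultAt (t ∷ ts) [] _ _ = ∑-zero (upTo (length (t ∷ ts))) (λ _ → refl)
∑-columnResultAt (t ∷ ts) (u ∷ us) (s≤s us≤ts) distinct = begin
  ∑[ c ← upTo (suc (length ts)) ] 𝟙 (columnResultAt (t ∷ ts) (u ∷ us) c)
    ≡⟨ ∑-upTo-suc (length ts) _ ⟩
  𝟙 (columnResultAt (t ∷ ts) (u ∷ us) 0) + ∑[ c ← upTo (length ts) ] 𝟙 (columnResultAt ts us c)
    ≡⟨ cong (𝟙 (columnResultAt (t ∷ ts) (u ∷ us) 0) +_) (∑-columnResultAt ts us us≤ts (distinct ∘ suc)) ⟩
  𝟙 (columnResultAt (t ∷ ts) (u ∷ us) 0) + changes nothing (columnBits us ts)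
    ≡⟨ columnResultAt-head t u ts us us≤ts (distinct 1) ⟩
  changes (just (u <ᵇ t)) (columnBits us ts) ∎
  where open ≡-Reasoning

inversions≡changes : ∀ {a b} (f : Filling a b) → b ≤ a →
  ColumnsDistinct (Vec.toList (top f)) (Vec.toList (bottom f)) →
  inversions f ≡ changes nothing (columnBits (Vec.toList (bottom f)) (Vec.toList (top f)))
inversions≡changes {a} {b} f b≤a distinct = begin
  inversions f
    ≡⟨ countB≡∑ (columnInversion f) (upTo a) ⟩
  ∑[ c ← upTo a ] 𝟙 (columnInversion f c)
    ≡⟨ ∑-cong (upTo a) (λ c → cong 𝟙 (columnInversion-distinct f c distinct)) ⟩
  ∑[ c ← upTo a ] 𝟙 (columnResultAt ts us c)
    ≡⟨ cong (λ n → ∑[ c ← upTo n ] 𝟙 (columnResultAt ts us c)) (sym (Vec.length-toList (top f))) ⟩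
  ∑[ c ← upTo (length ts) ] 𝟙 (columnResultAt ts us c)
    ≡⟨ ∑-columnResultAt ts us bottom≤top distinct ⟩
  changes nothing (columnBits us ts) ∎
  where
  open ≡-Reasoning
  ts = Vec.toList (top f)
  us = Vec.toList (bottom f)
  bottom≤top : length us ≤ length ts
  bottom≤top = subst₂ _≤_ (sym (Vec.length-toList (bottom f))) (sym (Vec.length-toList (top f))) b≤a

columnBits-∷ : ∀ s us L → 1 ≤ length L → All (s <_) L →
  columnBits (s ∷ us) L ≡ true ∷ columnBits us (drop 1 L)
columnBits-∷ s us (t ∷ L) _ (s<t ∷ _) = cong (_∷ columnBits us L) (dec-true (s <? t) s<t)

module _ {a b : ℕ} (b≤a : b ≤ a) where

  private
    ends-below : ∀ w {x y} → endsAt a b x y w ≡ true → y + occurrences false w ≤ x + occurrences true w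
    ends-below w {x} {y} ends = subst₂ _≤_ (sym (proj₂ counts)) (sym (proj₁ counts)) b≤a
      where counts = endsAt⁻ a b x y w ends

    room : ∀ x d {o f} → x + suc d + f ≤ x + o → d < o
    room x d {o} {f} le = +-cancelˡ-≤ x (suc d) o (≤-trans (m≤m+n (x + suc d) f) le)

  -- Reading a path to (a, b) from (x, y), with labels from s, the falses still to come are matched
  -- column by column with the trues numbered y, y + 1, ...  Either x = length P + y and P lists the
  -- labels of the trues read but not yet matched, or y = x + suc d and the next suc d trues to come
  -- are already matched.
  mutual
    northAbove-pending : ∀ w s {x y} (P : List ℕ) → length P + y ≡ x → All (_< s) P → endsAt a b x y w ≡ true →
      northAbove w x y ≡ columnBits (positions false s w) (P ++ positions true s w)
    northAbove-pending [] s P _ _ _ = refl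
    northAbove-pending (true ∷ w) s {x} {y} P P+y≡x P<s ends = begin
      northAbove w (suc x) y
        ≡⟨ northAbove-pending w (suc s) (P ++ [ s ])
             (trans (cong (_+ y) (trans (List.length-++ P) (+-comm (length P) 1))) (cong suc P+y≡x))
             (++⁺ (All.map m<n⇒m<1+n P<s) (≤-refl ∷ [])) ends ⟩
      columnBits (positions false (suc s) w) ((P ++ [ s ]) ++ positions true (suc s) w)
        ≡⟨ cong (columnBits (positions false (suc s) w)) (List.++-assoc P [ s ] (positions true (suc s) w)) ⟩
      columnBits (positions false (suc s) w) (P ++ s ∷ positions true (suc s) w) ∎
      where open ≡-Reasoning
    northAbove-pending (false ∷ w) s {x} {y} (p ∷ P) P+y≡x (p<s ∷ P<s) ends =
      cong₂ _∷_ (trans (dec-false (x ≤? y) (<⇒≱ y<x)) (sym (dec-false (s <? p) (<⇒≯ p<s))))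
                (northAbove-pending w (suc s) P (trans (+-suc (length P) y) P+y≡x) (All.map m<n⇒m<1+n P<s) ends)
      where
      y<x : y < x
      y<x = subst (y <_) P+y≡x (s≤s (m≤n+m y (length P)))
    northAbove-pending (false ∷ w) s {y = y} [] refl [] ends = begin
      (y ≤ᵇ y) ∷ northAbove w y (suc y)
        ≡⟨ cong₂ _∷_ (dec-true (y ≤? y) ≤-refl) (northAbove-ahead w (suc s) 0 (+-comm y 1) ends) ⟩
      true ∷ columnBits (positions false (suc s) w) (drop 1 (positions true (suc s) w))
        ≡⟨ columnBits-∷ s (positions false (suc s) w) (positions true (suc s) w) nonempty (positions-above true s w) ⟨
      columnBits (s ∷ positions false (suc s) w) (positions true (suc s) w) ∎
      where
      open ≡-Reasoning
      nonempty : 1 ≤ length (positions true (suc s) w)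
      nonempty = subst (1 ≤_) (sym (length-positions true (suc s) w))
                   (room y 0 (subst (_≤ y + occurrences true w) (cong (_+ occurrences false w) (+-comm 1 y))
                                    (ends-below w ends)))

    northAbove-ahead : ∀ w s {x y} d → x + suc d ≡ y → endsAt a b x y w ≡ true →
      northAbove w x y ≡ columnBits (positions false s w) (drop (suc d) (positions true s w))
    northAbove-ahead [] s d _ _ = refl
    northAbove-ahead (true ∷ w) s {x} zero x+1≡y ends =
      northAbove-pending w (suc s) [] (trans (sym x+1≡y) (+-comm x 1)) [] ends
    northAbove-ahead (true ∷ w) s {x} (suc d) x+2+d≡y ends =
      northAbove-ahead w (suc s) d (trans (sym (+-suc x (suc d))) x+2+d≡y) ends
    northAbove-ahead (false ∷ w) s {x} {y} d x+1+d≡y ends = begin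
      (x ≤ᵇ y) ∷ northAbove w x (suc y)
        ≡⟨ cong₂ _∷_ (dec-true (x ≤? y) (subst (x ≤_) x+1+d≡y (m≤m+n x (suc d))))
                     (northAbove-ahead w (suc s) (suc d) (trans (+-suc x (suc d)) (cong suc x+1+d≡y)) ends) ⟩
      true ∷ columnBits (positions false (suc s) w) (drop (suc (suc d)) (positions true (suc s) w))
        ≡⟨ cong (λ L → true ∷ columnBits (positions false (suc s) w) L) (drop-suc (suc d)) ⟨
      true ∷ columnBits (positions false (suc s) w) (drop 1 (drop (suc d) F))
        ≡⟨ columnBits-∷ s (positions false (suc s) w) (drop (suc d) F) nonempty
                        (drop⁺ (suc d) (positions-above true s w)) ⟨
      columnBits (s ∷ positions false (suc s) w) (drop (suc d) F) ∎
      where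
      open ≡-Reasoning
      F = positions true (suc s) w
      drop-suc : ∀ n → drop 1 (drop n F) ≡ drop (suc n) F
      drop-suc n = trans (List.drop-drop n 1 F) (cong (λ m → drop m F) (+-comm n 1))
      nonempty : 1 ≤ length (drop (suc d) F)
      nonempty = subst (1 ≤_) (sym (trans (List.length-drop (suc d) F) (cong (_∸ suc d) (length-positions true (suc s) w))))
                   (m<n⇒0<n∸m (room x (suc d) (subst (λ z → z + occurrences false w ≤ x + occurrences true w)
                                                    (trans (cong suc (sym x+1+d≡y)) (sym (+-suc x (suc d))))
                                                    (ends-below w ends))))

  northAbove≡columnBits : ∀ w → endsAt a b 0 0 w ≡ true →
    northAbove w 0 0 ≡ columnBits (positions false 1 w) (positions true 1 w)
  northAbove≡columnBits w = northAbove-pending w 1 [] refl []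

entry-elemB : ∀ L c {x} → entry L c ≡ just x → elemB x L ≡ true
entry-elemB (y ∷ L) zero refl = elemB-here y L
entry-elemB (y ∷ L) (suc c) {x} e = trans (cong ((x ≡ᵇ y) ∨_) (entry-elemB L c e)) (∨-zeroʳ (x ≡ᵇ y))

positions-columnsDistinct : ∀ s w → ColumnsDistinct (positions true s w) (positions false s w)
positions-columnsDistinct s w c x eₜ eᵤ
  with trans (sym (positions-disjoint s w x (entry-elemB (positions true s w) c eₜ)))
             (entry-elemB (positions false s w) c eᵤ)
... | ()

inversions-fillingOf : ∀ a b w → b ≤ a → endsAt a b 0 0 w ≡ true →
  inversions (fillingOf a b w) ≡ changes nothing (northAbove w 0 0)
inversions-fillingOf a b w b≤a ends = begin
  inversions (fillingOf a b w)
    ≡⟨ inversions≡changes (fillingOf a b w) b≤a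
         (subst₂ ColumnsDistinct (sym (top-fillingOf a b w ends)) (sym (bottom-fillingOf a b w ends))
                 (positions-columnsDistinct 1 w)) ⟩
  changes nothing (columnBits (Vec.toList (bottom (fillingOf a b w))) (Vec.toList (top (fillingOf a b w))))
    ≡⟨ cong₂ (λ us ts → changes nothing (columnBits us ts))
             (bottom-fillingOf a b w ends) (top-fillingOf a b w ends) ⟩
  changes nothing (columnBits (positions false 1 w) (positions true 1 w))
    ≡⟨ cong (changes nothing) (northAbove≡columnBits b≤a w ends) ⟨
  changes nothing (northAbove w 0 0) ∎
  where open ≡-Reasoning

-- Generating functions

-- Polynomials in q, as coefficient sequences.
Poly : Set
Poly = ℕ → ℕ

module ≗-Reasoning = Relation.Binary.Reasoning.Setoid (ℕ →-setoid ℕ)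

infixl 6 _⊕_

_⊕_ : Poly → Poly → Poly
(f ⊕ g) k = f k + g k

shift : Poly → Poly
shift f zero = 0
shift f (suc k) = f k

shiftIf : Bool → Poly → Poly
shiftIf true = shift
shiftIf false f = f

1+q· : Poly → Poly
1+q· f = f ⊕ shift f

odd : ℕ → Bool
odd zero = false
odd (suc k) = not (odd k)

-- The terms of f of parity c (true: odd).
part : Bool → Poly → Poly
part c f k = if c xor odd k then 0 else f k

⊕-cong : ∀ {f f′ g g′} → f ≗ f′ → g ≗ g′ → f ⊕ g ≗ f′ ⊕ g′
⊕-cong f≗f′ g≗g′ k = cong₂ _+_ (f≗f′ k) (g≗g′ k)

⊕-comm : ∀ f g → f ⊕ g ≗ g ⊕ f
⊕-comm f g k = +-comm (f k) (g k)

shift-cong : ∀ {f g} → f ≗ g → shift f ≗ shift g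
shift-cong f≗g zero = refl
shift-cong f≗g (suc k) = f≗g k

shiftIf-cong : ∀ c {f g} → f ≗ g → shiftIf c f ≗ shiftIf c g
shiftIf-cong true = shift-cong
shiftIf-cong false f≗g = f≗g

part-cong : ∀ c {f g} → f ≗ g → part c f ≗ part c g
part-cong c f≗g k = cong (λ v → if c xor odd k then 0 else v) (f≗g k)

shift-⊕ : ∀ f g → shift (f ⊕ g) ≗ shift f ⊕ shift g
shift-⊕ f g zero = refl
shift-⊕ f g (suc k) = refl

shiftIf-⊕ : ∀ c f g → shiftIf c (f ⊕ g) ≗ shiftIf c f ⊕ shiftIf c g
shiftIf-⊕ true = shift-⊕
shiftIf-⊕ false f g k = refl

part-⊕ : ∀ c f g → part c (f ⊕ g) ≗ part c f ⊕ part c g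
part-⊕ c f g k with c xor odd k
... | true = refl
... | false = refl

part-shift : ∀ c f → part c (shift f) ≗ shift (part (not c) f)
part-shift c f zero = if-eta (c xor false)
part-shift false f (suc k) = refl
part-shift true f (suc k) = cong (λ z → if z then 0 else f k) (not-involutive (odd k))

part-false⊕part-true : ∀ f → part false f ⊕ part true f ≗ f
part-false⊕part-true f k with odd k
... | true = refl
... | false = +-identityʳ (f k)

1+q·-cong : ∀ {f g} → f ≗ g → 1+q· f ≗ 1+q· g
1+q·-cong f≗g = ⊕-cong f≗g (shift-cong f≗g)

part-shiftIf-below : ∀ c f g → part c (shiftIf c f) ⊕ shiftIf c (part false g) ≗ part c (shiftIf c (f ⊕ g))
part-shiftIf-below false f g k = sym (part-⊕ false f g k)
part-shiftIf-below true f g = begin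
  part true (shift f) ⊕ shift (part false g)         ≈⟨ ⊕-cong (λ _ → refl) (part-shift true g) ⟨
  part true (shift f) ⊕ part true (shift g)          ≈⟨ part-⊕ true (shift f) (shift g) ⟨
  part true (shift f ⊕ shift g)                      ≈⟨ part-cong true (shift-⊕ f g) ⟨
  part true (shift (f ⊕ g))                          ∎
  where open ≗-Reasoning

part-shiftIf-diagonal : ∀ c f → part c (shiftIf c f) ⊕ shiftIf (not c) (part true f) ≗ part c (1+q· f)
part-shiftIf-diagonal false f = begin
  part false f ⊕ shift (part true f)                 ≈⟨ ⊕-cong (λ _ → refl) (part-shift false f) ⟨
  part false f ⊕ part false (shift f)                ≈⟨ part-⊕ false f (shift f) ⟨
  part false (1+q· f)                                ∎
  where open ≗-Reasoning
part-shiftIf-diagonal true f = begin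
  part true (shift f) ⊕ part true f                  ≈⟨ ⊕-comm (part true (shift f)) (part true f) ⟩
  part true f ⊕ part true (shift f)                  ≈⟨ part-⊕ true f (shift f) ⟨
  part true (1+q· f)                                 ∎
  where open ≗-Reasoning

C-suc : ∀ r → _C_ (suc r) ≗ 1+q· (_C_ r)
C-suc r zero = refl
C-suc r (suc k) = trans (sym (nCk+nC[k+1]≡[n+1]C[k+1] r k)) (+-comm (r C k) (r C suc k))

∑-1+q· : (xs : List A) (d : A → Bool) (r : A → ℕ) →
  (λ k → ∑[ x ← xs ] (if d x then suc (r x) C k else 0))
    ≗ 1+q· (λ k → ∑[ x ← xs ] (if d x then r x C k else 0))
∑-1+q· xs d r k = begin
  ∑[ x ← xs ] (if d x then suc (r x) C k else 0)
    ≡⟨ ∑-cong xs (λ x → split (d x) (r x)) ⟩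
  ∑[ x ← xs ] ((if d x then r x C k else 0) + (if d x then shift (_C_ (r x)) k else 0))
    ≡⟨ ∑-+ xs _ _ ⟩
  ∑[ x ← xs ] (if d x then r x C k else 0) + ∑[ x ← xs ] (if d x then shift (_C_ (r x)) k else 0)
    ≡⟨ cong (∑[ x ← xs ] (if d x then r x C k else 0) +_) (∑-shift k) ⟩
  1+q· (λ j → ∑[ x ← xs ] (if d x then r x C j else 0)) k ∎
  where
  open ≡-Reasoning
  split : ∀ e n → (if e then suc n C k else 0) ≡ (if e then n C k else 0) + (if e then shift (_C_ n) k else 0)
  split true n = C-suc n k
  split false n = refl
  ∑-shift : ∀ k → ∑[ x ← xs ] (if d x then shift (_C_ (r x)) k else 0)
                  ≡ shift (λ j → ∑[ x ← xs ] (if d x then r x C j else 0)) k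
  ∑-shift zero = ∑-zero xs (λ x → if-eta (d x))
  ∑-shift (suc k) = refl

∑-shiftIf : (xs : List A) (E : A → Bool) (X : A → ℕ) (z : Bool) →
  (λ k → ∑[ x ← xs ] 𝟙 (E x ∧ (𝟙 z + X x ≡ᵇ k)))
    ≗ shiftIf z (λ k → ∑[ x ← xs ] 𝟙 (E x ∧ (X x ≡ᵇ k)))
∑-shiftIf xs E X false k = refl
∑-shiftIf xs E X true zero = ∑-zero xs (λ x → cong 𝟙 (∧-zeroʳ (E x)))
∑-shiftIf xs E X true (suc k) = refl

module Continuations (a b : ℕ) where

  changesGF : ℕ → ℕ → ℕ → Maybe Bool → Poly
  changesGF m x y c k = ∑[ p ← allPaths m ] 𝟙 (endsAt a b x y p ∧ (changes c (northAbove p x y) ≡ᵇ k))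

  returnsGF : ℕ → ℕ → ℕ → Poly
  returnsGF m x y k = ∑[ p ← allPaths m ] (if dyckFrom a b x y p then returnsFrom x y p C k else 0)

  changesGF-step : ∀ m x y c β → (x ≤ᵇ y) ≡ β →
    changesGF (suc m) x y (just c) ≗ changesGF m (suc x) y (just c) ⊕ shiftIf (c xor β) (changesGF m x (suc y) (just β))
  changesGF-step m x y c _ refl k =
    trans (∑-allPaths-suc m _)
      (cong (changesGF m (suc x) y (just c) k +_)
        (∑-shiftIf (allPaths m) (endsAt a b x (suc y)) (λ p → changes (just (x ≤ᵇ y)) (northAbove p x (suc y)))
                   (c xor (x ≤ᵇ y)) k))

  changesGF-step-below : ∀ m {x y} c → y < x →
    changesGF (suc m) x y (just c) ≗ changesGF m (suc x) y (just c) ⊕ shiftIf c (changesGF m x (suc y) (just false))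
  changesGF-step-below m {x} {y} c y<x k =
    trans (changesGF-step m x y c false (dec-false (x ≤? y) (<⇒≱ y<x)) k)
      (cong (λ z → changesGF m (suc x) y (just c) k + shiftIf z (changesGF m x (suc y) (just false)) k) (xor-identityʳ c))

  changesGF-step-above : ∀ m {x y} c → x ≤ y →
    changesGF (suc m) x y (just c) ≗ changesGF m (suc x) y (just c) ⊕ shiftIf (not c) (changesGF m x (suc y) (just true))
  changesGF-step-above m {x} {y} c x≤y k =
    trans (changesGF-step m x y c true (dec-true (x ≤? y) x≤y) k)
      (cong (λ z → changesGF m (suc x) y (just c) k + shiftIf z (changesGF m x (suc y) (just true)) k) (xor-comm c true))

  returnsGF-via : Bool → ℕ → ℕ → ℕ → Poly
  returnsGF-via s m x y k = ∑[ p ← allPaths m ] (if dyckFrom a b x y (s ∷ p) then returnsFrom x y (s ∷ p) C k else 0)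

  returnsGF-east : ∀ m {x y} → y ≤ x → returnsGF-via true m x y ≗ returnsGF m (suc x) y
  returnsGF-east m {x} {y} y≤x k = ∑-cong (allPaths m) λ p →
    cong (λ v → if dyckFrom a b (suc x) y p then ((if v then 1 else 0) + returnsFrom (suc x) y p) C k else 0)
         (dec-false (suc x ≟ y) (>⇒≢ (s≤s y≤x)))

  returnsGF-north : ∀ m x y u v → (suc y ≤ᵇ x) ≡ u → (x ≡ᵇ suc y) ≡ v → returnsGF-via false m x y ≗
    λ k → ∑[ p ← allPaths m ]
            (if u ∧ dyckFrom a b x (suc y) p then ((if v then 1 else 0) + returnsFrom x (suc y) p) C k else 0)
  returnsGF-north m x y _ _ refl refl k = refl

  returnsGF-diagonal : ∀ m x → returnsGF (suc m) x x ≗ returnsGF m (suc x) x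
  returnsGF-diagonal m x k = begin
    returnsGF (suc m) x x k
      ≡⟨ ∑-allPaths-suc m _ ⟩
    returnsGF-via true m x x k + returnsGF-via false m x x k
      ≡⟨ cong₂ _+_ (returnsGF-east m ≤-refl k)
                   (trans (returnsGF-north m x x false (x ≡ᵇ suc x) (dec-false (suc x ≤? x) (<-irrefl refl)) refl k)
                          (∑-zero (allPaths m) (λ _ → refl))) ⟩
    returnsGF m (suc x) x k + 0
      ≡⟨ +-identityʳ _ ⟩
    returnsGF m (suc x) x k ∎
    where open ≡-Reasoning

  returnsGF-far : ∀ m {x y} → suc y < x → returnsGF (suc m) x y ≗ returnsGF m (suc x) y ⊕ returnsGF m x (suc y)
  returnsGF-far m {x} {y} 1+y<x k =
    trans (∑-allPaths-suc m _)
      (cong₂ _+_ (returnsGF-east m (<⇒≤ (<-trans (n<1+n y) 1+y<x)) k)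
                 (returnsGF-north m x y true false (dec-true (suc y ≤? x) (<⇒≤ 1+y<x))
                                  (dec-false (x ≟ suc y) (>⇒≢ 1+y<x)) k))

  returnsGF-adjacent : ∀ m y →
    returnsGF (suc m) (suc y) y ≗ returnsGF m (suc (suc y)) y ⊕ 1+q· (returnsGF m (suc y) (suc y))
  returnsGF-adjacent m y k =
    trans (∑-allPaths-suc m _)
      (cong₂ _+_ (returnsGF-east m (n≤1+n y) k)
                 (trans (returnsGF-north m (suc y) y true true (dec-true (suc y ≤? suc y) ≤-refl)
                                         (dec-true (suc y ≟ suc y) refl) k)
                        (∑-1+q· (allPaths m) (dyckFrom a b (suc y) (suc y)) (returnsFrom (suc y) (suc y)) k)))

  -- The sides recorded run from c to a final false, which fixes the parity of the number of
  -- changes; otherwise every return still to come (on the diagonal, also the excursion about to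
  -- start) contributes a factor 1 + q, and below the diagonal the current side costs q^c.
  record Invariant (m : ℕ) : Set where
    field
      below : ∀ {x y} → y < x → ∀ c → changesGF m x y (just c) ≗ part c (shiftIf c (returnsGF m x y))
      diagonal : ∀ x c → changesGF m x x (just c) ≗ part c (1+q· (returnsGF m x x))
      above : ∀ {x y} → x < y → changesGF m x y (just true) ≗ part true (returnsGF m y x)

  invariant-zero : b ≤ a → Invariant 0
  invariant-zero b≤a = record
    { below = λ {x} {y} _ c → base-below ((x ≡ᵇ a) ∧ (y ≡ᵇ b)) c
    ; diagonal = λ x c → base-diagonal ((x ≡ᵇ a) ∧ (x ≡ᵇ b)) c
    ; above = λ {x} {y} x<y k → trans (cong (λ e → 𝟙 (e ∧ (1 ≡ᵇ k)) + 0) (not-at-end x<y))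
                                      (sym (base-above ((y ≡ᵇ a) ∧ (x ≡ᵇ b)) k))
    }
    where
    base-below : ∀ e c k →
      𝟙 (e ∧ (𝟙 c ≡ᵇ k)) + 0 ≡ part c (shiftIf c (λ j → (if e then 0 C j else 0) + 0)) k
    base-below false false k = sym (if-eta (odd k))
    base-below false true zero = refl
    base-below false true (suc k) = sym (if-eta (not (not (odd k))))
    base-below true false zero = refl
    base-below true false (suc k) = sym (if-eta (not (odd k)))
    base-below true true zero = refl
    base-below true true (suc zero) = refl
    base-below true true (suc (suc k)) = sym (if-eta (not (not (not (odd k)))))
    base-diagonal : ∀ e c k →
      𝟙 (e ∧ (𝟙 c ≡ᵇ k)) + 0 ≡ part c (1+q· (λ j → (if e then 0 C j else 0) + 0)) k
    base-diagonal false false zero = refl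
    base-diagonal false false (suc k) = sym (if-eta (not (odd k)))
    base-diagonal false true zero = refl
    base-diagonal false true (suc k) = sym (if-eta (not (not (odd k))))
    base-diagonal true false zero = refl
    base-diagonal true false (suc zero) = refl
    base-diagonal true false (suc (suc k)) = sym (if-eta (not (not (odd k))))
    base-diagonal true true zero = refl
    base-diagonal true true (suc zero) = refl
    base-diagonal true true (suc (suc k)) = sym (if-eta (not (not (not (odd k)))))
    base-above : ∀ e k → part true (λ j → (if e then 0 C j else 0) + 0) k ≡ 0
    base-above e zero = refl
    base-above e (suc k) =
      trans (cong (λ v → if not (not (odd k)) then 0 else v + 0) (if-eta e)) (if-eta (not (not (odd k))))
    not-at-end : ∀ {x y} → x < y → (x ≡ᵇ a) ∧ (y ≡ᵇ b) ≡ false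
    not-at-end {x} {y} x<y with x ≟ a | y ≟ b
    ... | yes refl | yes refl = ⊥-elim (<⇒≱ x<y b≤a)
    ... | no x≢a | _ = cong (_∧ (y ≡ᵇ b)) (dec-false (x ≟ a) x≢a)
    ... | yes _ | no y≢b = trans (cong ((x ≡ᵇ a) ∧_) (dec-false (y ≟ b) y≢b)) (∧-zeroʳ (x ≡ᵇ a))

  module _ {m : ℕ} (inv : Invariant m) where
    open Invariant inv
    open ≗-Reasoning

    private
      below-via : ∀ {x y} (f g : Poly) → y < x → ∀ c →
        changesGF m (suc x) y (just c) ≗ part c (shiftIf c f) →
        changesGF m x (suc y) (just false) ≗ part false g →
        returnsGF (suc m) x y ≗ f ⊕ g →
        changesGF (suc m) x y (just c) ≗ part c (shiftIf c (returnsGF (suc m) x y))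
      below-via {x} {y} f g y<x c east north split = begin
        changesGF (suc m) x y (just c)
          ≈⟨ changesGF-step-below m c y<x ⟩
        changesGF m (suc x) y (just c) ⊕ shiftIf c (changesGF m x (suc y) (just false))
          ≈⟨ ⊕-cong east (shiftIf-cong c north) ⟩
        part c (shiftIf c f) ⊕ shiftIf c (part false g)
          ≈⟨ part-shiftIf-below c f g ⟩
        part c (shiftIf c (f ⊕ g))
          ≈⟨ part-cong c (shiftIf-cong c split) ⟨
        part c (shiftIf c (returnsGF (suc m) x y)) ∎

      above-via : ∀ {x y} (f g : Poly) → x < y →
        changesGF m (suc x) y (just true) ≗ part true f →
        changesGF m x (suc y) (just true) ≗ part true g →
        returnsGF (suc m) y x ≗ g ⊕ f →
        changesGF (suc m) x y (just true) ≗ part true (returnsGF (suc m) y x)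
      above-via {x} {y} f g x<y east north split = begin
        changesGF (suc m) x y (just true)
          ≈⟨ changesGF-step-above m true (<⇒≤ x<y) ⟩
        changesGF m (suc x) y (just true) ⊕ changesGF m x (suc y) (just true)
          ≈⟨ ⊕-cong east north ⟩
        part true f ⊕ part true g
          ≈⟨ ⊕-comm (part true f) (part true g) ⟩
        part true g ⊕ part true f
          ≈⟨ part-⊕ true g f ⟨
        part true (g ⊕ f)
          ≈⟨ part-cong true split ⟨
        part true (returnsGF (suc m) y x) ∎

    below-suc : ∀ {x y} → y < x → ∀ c →
      changesGF (suc m) x y (just c) ≗ part c (shiftIf c (returnsGF (suc m) x y))
    below-suc {x} {y} y<x c with m≤n⇒m<n∨m≡n y<x
    ... | inj₁ 1+y<x = below-via _ _ y<x c (below (m<n⇒m<1+n y<x) c) (below 1+y<x false) (returnsGF-far m 1+y<x)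
    ... | inj₂ refl = below-via _ _ y<x c (below (m<n⇒m<1+n y<x) c) (diagonal (suc y) false) (returnsGF-adjacent m y)

    diagonal-suc : ∀ x c → changesGF (suc m) x x (just c) ≗ part c (1+q· (returnsGF (suc m) x x))
    diagonal-suc x c = begin
      changesGF (suc m) x x (just c)
        ≈⟨ changesGF-step-above m c ≤-refl ⟩
      changesGF m (suc x) x (just c) ⊕ shiftIf (not c) (changesGF m x (suc x) (just true))
        ≈⟨ ⊕-cong (below (n<1+n x) c) (shiftIf-cong (not c) (above (n<1+n x))) ⟩
      part c (shiftIf c (returnsGF m (suc x) x)) ⊕ shiftIf (not c) (part true (returnsGF m (suc x) x))
        ≈⟨ part-shiftIf-diagonal c (returnsGF m (suc x) x) ⟩
      part c (1+q· (returnsGF m (suc x) x))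
        ≈⟨ part-cong c (1+q·-cong (returnsGF-diagonal m x)) ⟨
      part c (1+q· (returnsGF (suc m) x x)) ∎

    above-suc : ∀ {x y} → x < y → changesGF (suc m) x y (just true) ≗ part true (returnsGF (suc m) y x)
    above-suc {x} {y} x<y with m≤n⇒m<n∨m≡n x<y
    ... | inj₁ 1+x<y = above-via _ _ x<y (above 1+x<y) (above (m<n⇒m<1+n x<y)) (returnsGF-far m 1+x<y)
    ... | inj₂ refl = above-via _ _ x<y (diagonal (suc x) true) (above (m<n⇒m<1+n x<y)) (returnsGF-adjacent m x)

  invariant : b ≤ a → ∀ m → Invariant m
  invariant b≤a zero = invariant-zero b≤a
  invariant b≤a (suc m) = record { below = below-suc inv ; diagonal = diagonal-suc inv ; above = above-suc inv }
    where inv = invariant b≤a m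

  changes-nothing-below : ∀ p {x y} → y < x →
    changes nothing (northAbove p x y) ≡ changes (just false) (northAbove p x y)
  changes-nothing-below [] _ = refl
  changes-nothing-below (true ∷ p) y<x = changes-nothing-below p (m<n⇒m<1+n y<x)
  changes-nothing-below (false ∷ p) {x} {y} y<x = first-false (x ≤ᵇ y) (dec-false (x ≤? y) (<⇒≱ y<x))
    where
    first-false : ∀ β → β ≡ false →
      changes nothing (β ∷ northAbove p x (suc y)) ≡ changes (just false) (β ∷ northAbove p x (suc y))
    first-false .false refl = refl

  changesGF-origin : b ≤ a → ∀ {n} → 1 ≤ n → changesGF n 0 0 nothing ≗ returnsGF n 0 0
  changesGF-origin b≤a {suc m} _ k = begin
    changesGF (suc m) 0 0 nothing k
      ≡⟨ ∑-allPaths-suc m _ ⟩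
    changesGF m 1 0 nothing k + changesGF m 0 1 (just true) k
      ≡⟨ cong (_+ changesGF m 0 1 (just true) k)
              (∑-cong (allPaths m) λ p →
                 cong (λ n → 𝟙 (endsAt a b 1 0 p ∧ (n ≡ᵇ k))) (changes-nothing-below p z<s)) ⟩
    changesGF m 1 0 (just false) k + changesGF m 0 1 (just true) k
      ≡⟨ cong₂ _+_ (below z<s false k) (above z<s k) ⟩
    part false (returnsGF m 1 0) k + part true (returnsGF m 1 0) k
      ≡⟨ part-false⊕part-true (returnsGF m 1 0) k ⟩
    returnsGF m 1 0 k
      ≡⟨ returnsGF-diagonal m 0 k ⟨
    returnsGF (suc m) 0 0 k ∎
    where
    open ≡-Reasoning
    open Invariant (invariant b≤a m)

∑-upTo-select : ∀ N r (h : ℕ → ℕ) → r < N → ∑[ i ← upTo N ] 𝟙 (r ≡ᵇ i) * h i ≡ h r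
∑-upTo-select (suc N) zero h _ =
  trans (∑-upTo-suc N (λ i → 𝟙 (0 ≡ᵇ i) * h i))
        (trans (cong (h 0 + 0 +_) (∑-zero (upTo N) (λ _ → refl))) (trans (+-identityʳ _) (+-identityʳ _)))
∑-upTo-select (suc N) (suc r) h (s≤s r<N) =
  trans (∑-upTo-suc N (λ i → 𝟙 (suc r ≡ᵇ i) * h i)) (∑-upTo-select N r (h ∘ suc) r<N)

returnsFrom-≤ : ∀ x y p → returnsFrom x y p ≤ length p
returnsFrom-≤ x y [] = z≤n
returnsFrom-≤ x y (true ∷ p) with suc x ≡ᵇ y
... | true = s≤s (returnsFrom-≤ (suc x) y p)
... | false = m≤n⇒m≤1+n (returnsFrom-≤ (suc x) y p)
returnsFrom-≤ x y (false ∷ p) with x ≡ᵇ suc y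
... | true = s≤s (returnsFrom-≤ x (suc y) p)
... | false = m≤n⇒m≤1+n (returnsFrom-≤ x (suc y) p)

rhsCoeff≡returnsGF : ∀ a b k → rhsCoeff a b k ≡ Continuations.returnsGF a b (a + b) 0 0 k
rhsCoeff≡returnsGF a b k = begin
  rhsCoeff a b k
    ≡⟨ sum-map≡∑ _ (upTo (suc n)) ⟩
  ∑[ i ← upTo (suc n) ] cardD a b i * (i C k)
    ≡⟨ ∑-cong (upTo (suc n)) (λ i → trans (cong (_* (i C k)) (countB≡∑ _ (allPaths n)))
                                          (sym (∑-*ʳ (i C k) (allPaths n) _))) ⟩
  ∑[ i ← upTo (suc n) ] ∑[ p ← allPaths n ] 𝟙 (isDyck a b p ∧ (returns p ≡ᵇ i)) * (i C k)
    ≡⟨ ∑-comm (upTo (suc n)) (allPaths n) _ ⟩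
  ∑[ p ← allPaths n ] ∑[ i ← upTo (suc n) ] 𝟙 (isDyck a b p ∧ (returns p ≡ᵇ i)) * (i C k)
    ≡⟨ ∑-congᴬ (All.map (λ {p} → select p) (allPaths-length n)) ⟩
  Continuations.returnsGF a b n 0 0 k ∎
  where
  open ≡-Reasoning
  n = a + b
  select : ∀ p → length p ≡ n →
    ∑[ i ← upTo (suc n) ] 𝟙 (isDyck a b p ∧ (returns p ≡ᵇ i)) * (i C k)
      ≡ (if isDyck a b p then returns p C k else 0)
  select p length≡n with isDyck a b p
  ... | false = ∑-zero (upTo (suc n)) (λ _ → refl)
  ... | true = ∑-upTo-select (suc n) (returns p) (_C k) (s≤s (subst (returns p ≤_) length≡n (returnsFrom-≤ 0 0 p)))

mainTheorem12 : (a b : ℕ) → b ≤ a → 1 ≤ b →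
    (k : ℕ) → cardS a b k ≡ rhsCoeff a b k
mainTheorem12 a b b≤a 1≤b k = begin
  cardS a b k
    ≡⟨ cardS≡∑-words a b k ⟩
  ∑[ w ← allPaths (a + b) ] 𝟙 (endsAt a b 0 0 w ∧ (inversions (fillingOf a b w) ≡ᵇ k))
    ≡⟨ ∑-cong (allPaths (a + b)) inversions≡changes-of-path ⟩
  changesGF (a + b) 0 0 nothing k
    ≡⟨ changesGF-origin b≤a (≤-trans 1≤b (m≤n+m b a)) k ⟩
  returnsGF (a + b) 0 0 k
    ≡⟨ rhsCoeff≡returnsGF a b k ⟨
  rhsCoeff a b k ∎
  where
  open ≡-Reasoning
  open Continuations a b
  inversions≡changes-of-path : ∀ w → 𝟙 (endsAt a b 0 0 w ∧ (inversions (fillingOf a b w) ≡ᵇ k))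
                                   ≡ 𝟙 (endsAt a b 0 0 w ∧ (changes nothing (northAbove w 0 0) ≡ᵇ k))
  inversions≡changes-of-path w with endsAt a b 0 0 w in ends
  ... | false = refl
  ... | true = cong (λ n → 𝟙 (n ≡ᵇ k)) (inversions-fillingOf a b w b≤a ends)
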